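{- Let $m\ge 4$ and $d=\lfloor m/2\rfloor$. Then the sequence $(m_0,\dots,m_d)$ of multiplicities of the folded Johnson graph $\overline{J}(2m,m)$, given by $m_i=\binom{2m}{2i}-\binom{2m}{2i-1}$ (with $\binom{2m}{ -1}=0$), is log-concave.
   Context: The folded Johnson graph $\overline{J}(2m,m)$ is obtained from the Johnson graph $J(2m,m)$ (vertices the $m$-subsets of a $2m$-set, adjacent when they meet in $m-1$ elements) by identifying each $m$-subset with its complement; it is distance-regular of diameter $d=\lfloor m/2\rfloor$, and its eigenvalue multiplicities in the standard ordering are $m_i=\binom{2m}{2i}-\binom{2m}{2i-1}$, $0\le i\le d$. A sequence $(s_0,\dots,s_d)$ is log-concave if $s_i^2\ge s_{i-1}s_{i+1}$ for all $1\le i\le d-1$. -}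

module Defs where

open import Data.Nat using (ℕ; zero; suc; _*_; _/_)
open import Data.Nat.Combinatorics using (_C_)
open import Data.Integer using (ℤ; +_; _-_)

-- binomial coefficient with the convention (n choose -1) = 0:
-- binomPred n k = (n choose (k - 1)) for k ≥ 1, and 0 for k = 0
binomPred : ℕ → ℕ → ℕ
binomPred n zero    = 0
binomPred n (suc k) = n C k

mult : ℕ → ℕ → ℤ
mult m i = + ((2 * m) C (2 * i)) - + binomPred (2 * m) (2 * i)

diam : ℕ → ℕ
diam m = m / 2

-- With n = 2m + 1 the multiplicity m_i is the ballot number b_{2i}, where
-- b_k = C(n-1,k) - C(n-1,k-1) satisfies n b_k = (n - 2k) C(n,k). Both k ↦ n - 2k
-- and k ↦ C(n,k) are log-concave, hence so is their product and therefore (b_k).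
-- Since b_k > 0 for 2k < n, log-concavity passes to the subsequence (b_{2i}).
module Submission where

open import Defs
open import Data.Nat using (ℕ; suc; pred; _≤_)

-- A submodule, so that its ℕ multiplication does not clash with the ℤ one of the statement.
module BallotNumbers where

  open import Data.Nat using (zero; _+_; _*_; _∸_; _<_; z≤n; s≤s; NonZero; >-nonZero; _/_)
  open import Data.Nat.Properties
  open import Data.Nat.DivMod using (m/n*n≤m)
  open import Data.Nat.Combinatorics using (_C_; nCk+nC[k+1]≡[n+1]C[k+1]; nC1≡n; k>n⇒nCk≡0)
  open import Data.Nat.Tactic.RingSolver using (solve-∀)
  open import Algebra.Properties.CommutativeSemigroup *-commutativeSemigroup using (interchange)
  import Data.Integer as ℤ
  open import Data.Integer.Properties using (m-n≡m⊖n; ⊖-≥; pos-*)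
  open import Relation.Binary.PropositionalEquality
  open import Relation.Nullary using (yes; no)

  C-absorption : ∀ n k → suc k * (suc n C suc k) ≡ suc n * (n C k)
  C-absorption zero    zero    = refl
  C-absorption zero    (suc k) = *-zeroʳ (2 + k)
  C-absorption (suc n) zero    =
    trans (+-identityʳ (suc (suc n) C 1)) (trans (nC1≡n (2 + n)) (sym (*-identityʳ (2 + n))))
  C-absorption (suc n) (suc k) = begin
      suc (suc k) * (suc (suc n) C suc (suc k))
    ≡⟨ cong (suc (suc k) *_) (sym (nCk+nC[k+1]≡[n+1]C[k+1] (suc n) (suc k))) ⟩
      suc (suc k) * (x + y)
    ≡⟨ *-distribˡ-+ (suc (suc k)) x y ⟩
      x + suc k * x + suc (suc k) * y
    ≡⟨ cong₂ (λ a b → x + a + b) (C-absorption n k) (C-absorption n (suc k)) ⟩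
      x + suc n * (n C k) + suc n * (n C suc k)
    ≡⟨ +-assoc x (suc n * (n C k)) (suc n * (n C suc k)) ⟩
      x + (suc n * (n C k) + suc n * (n C suc k))
    ≡⟨ cong (x +_) (sym (*-distribˡ-+ (suc n) (n C k) (n C suc k))) ⟩
      x + suc n * (n C k + n C suc k)
    ≡⟨ cong (λ a → x + suc n * a) (nCk+nC[k+1]≡[n+1]C[k+1] n k) ⟩
      suc (suc n) * x
    ∎
    where
    open ≡-Reasoning
    x = suc n C suc k
    y = suc n C suc (suc k)

  C-pascal : ∀ n k → suc n C k ≡ n C k + binomPred n k
  C-pascal n zero    = refl
  C-pascal n (suc k) = trans (sym (nCk+nC[k+1]≡[n+1]C[k+1] n k)) (+-comm (n C k) (n C suc k))

  binomPred-absorption : ∀ n k → suc n * binomPred n k ≡ k * (suc n C k)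
  binomPred-absorption n zero    = *-zeroʳ (suc n)
  binomPred-absorption n (suc k) = sym (C-absorption n k)

  C-absorption-complement : ∀ n k → suc n * (n C k) ≡ (suc n ∸ k) * (suc n C k)
  C-absorption-complement n k = begin
      suc n * (n C k)
    ≡⟨ sym (m+n∸n≡m (suc n * (n C k)) (k * X)) ⟩
      suc n * (n C k) + k * X ∸ k * X
    ≡⟨ cong (_∸ k * X) split ⟩
      suc n * X ∸ k * X
    ≡⟨ sym (*-distribʳ-∸ X (suc n) k) ⟩
      (suc n ∸ k) * X
    ∎
    where
    open ≡-Reasoning
    X = suc n C k
    split : suc n * (n C k) + k * X ≡ suc n * X
    split = begin
        suc n * (n C k) + k * X
      ≡⟨ cong (suc n * (n C k) +_) (sym (binomPred-absorption n k)) ⟩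
        suc n * (n C k) + suc n * binomPred n k
      ≡⟨ sym (*-distribˡ-+ (suc n) (n C k) (binomPred n k)) ⟩
        suc n * (n C k + binomPred n k)
      ≡⟨ cong (suc n *_) (sym (C-pascal n k)) ⟩
        suc n * X
      ∎

  C-ratio : ∀ n k → suc k * (n C suc k) ≡ (n ∸ k) * (n C k)
  C-ratio zero    k = trans (*-zeroʳ (suc k)) (sym (cong (_* (0 C k)) (0∸n≡0 k)))
  C-ratio (suc n) k = trans (C-absorption n k) (C-absorption-complement n k)

  0<C : ∀ {n k} → k ≤ n → 0 < n C k
  0<C {n}     {zero}  _         = s≤s z≤n
  0<C {suc n} {suc k} (s≤s k≤n) =
    subst (0 <_) (nCk+nC[k+1]≡[n+1]C[k+1] n k) (≤-trans (0<C k≤n) (m≤m+n (n C k) (n C suc k)))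

  -- A record rather than a bare inequality, so that f and k are inferable from the type.
  record LogConcaveAt (f : ℕ → ℕ) (k : ℕ) : Set where
    constructor logConcaveAt
    field
      inequality : f k * f (2 + k) ≤ f (1 + k) * f (1 + k)

  LogConcaveAt-fromRatios : ∀ f k p q p′ q′ →
    p * f (1 + k) ≡ q * f k → p′ * f (2 + k) ≡ q′ * f (1 + k) →
    p * q′ ≤ p′ * q → 0 < q → 0 < p′ → LogConcaveAt f k
  LogConcaveAt-fromRatios f k p q p′ q′ step₁ step₂ p*q′≤p′*q 0<q 0<p′ =
    logConcaveAt (*-cancelˡ-≤ (q * p′) {{>-nonZero (*-mono-< 0<q 0<p′)}} (begin
      q * p′ * (f k * f (2 + k))           ≡⟨ interchange q p′ (f k) (f (2 + k)) ⟩
      q * f k * (p′ * f (2 + k))           ≡⟨ cong₂ _*_ (sym step₁) step₂ ⟩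
      p * f (1 + k) * (q′ * f (1 + k))     ≡⟨ interchange p (f (1 + k)) q′ (f (1 + k)) ⟩
      p * q′ * (f (1 + k) * f (1 + k))     ≤⟨ *-monoˡ-≤ (f (1 + k) * f (1 + k)) p*q′≤p′*q ⟩
      p′ * q * (f (1 + k) * f (1 + k))     ≡⟨ cong (_* (f (1 + k) * f (1 + k))) (*-comm p′ q) ⟩
      q * p′ * (f (1 + k) * f (1 + k))     ∎))
    where open ≤-Reasoning

  C-logConcave : ∀ n k → LogConcaveAt (n C_) k
  C-logConcave n k with k <? n
  ... | yes k<n = LogConcaveAt-fromRatios (n C_) k (suc k) (n ∸ k) (2 + k) (n ∸ suc k)
                    (C-ratio n k) (C-ratio n (suc k))
                    (*-mono-≤ (n≤1+n (suc k)) (∸-monoʳ-≤ n (n≤1+n k))) (m<n⇒0<n∸m k<n) (s≤s z≤n)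
  ... | no k≮n  = logConcaveAt (begin
      (n C k) * (n C (2 + k))         ≡⟨ cong ((n C k) *_) (k>n⇒nCk≡0 (s≤s (m≤n⇒m≤1+n (≮⇒≥ k≮n)))) ⟩
      (n C k) * 0                     ≡⟨ *-zeroʳ (n C k) ⟩
      0                               ≤⟨ z≤n ⟩
      (n C (1 + k)) * (n C (1 + k))   ∎)
    where open ≤-Reasoning

  LogConcaveAt-* : ∀ {f g k} → LogConcaveAt f k → LogConcaveAt g k →
                   LogConcaveAt (λ j → f j * g j) k
  LogConcaveAt-* {f} {g} {k} (logConcaveAt f-lc) (logConcaveAt g-lc) =
    logConcaveAt (subst₂ _≤_ (interchange (f k) (f (2 + k)) (g k) (g (2 + k)))
                             (interchange (f (1 + k)) (f (1 + k)) (g (1 + k)) (g (1 + k)))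
                             (*-mono-≤ f-lc g-lc))

  LogConcaveAt-scale : ∀ {f g k} c .{{_ : NonZero c}} → (∀ j → c * f j ≡ g j) →
                       LogConcaveAt g k → LogConcaveAt f k
  LogConcaveAt-scale {f} {g} {k} c scale (logConcaveAt g-lc) =
    logConcaveAt (*-cancelˡ-≤ (c * c) {{m*n≢0 c c}}
      (subst₂ _≤_ (scaled k (2 + k)) (scaled (1 + k) (1 + k)) g-lc))
    where
    scaled : ∀ i j → g i * g j ≡ c * c * (f i * f j)
    scaled i j = trans (sym (cong₂ _*_ (scale i) (scale j))) (interchange c (f i) c (f j))

  n*[n∸4]≤[n∸2]*[n∸2] : ∀ n → n * (n ∸ 4) ≤ (n ∸ 2) * (n ∸ 2)
  n*[n∸4]≤[n∸2]*[n∸2] 0 = z≤n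
  n*[n∸4]≤[n∸2]*[n∸2] 1 = z≤n
  n*[n∸4]≤[n∸2]*[n∸2] 2 = z≤n
  n*[n∸4]≤[n∸2]*[n∸2] 3 = z≤n
  n*[n∸4]≤[n∸2]*[n∸2] (suc (suc (suc (suc w)))) =
    ≤-trans (m≤m+n ((4 + w) * w) 4) (≤-reflexive (square w))
    where
    square : ∀ w → (4 + w) * w + 4 ≡ (2 + w) * (2 + w)
    square = solve-∀

  ∸2*-logConcave : ∀ v k → LogConcaveAt (λ j → v ∸ 2 * j) k
  ∸2*-logConcave v k = logConcaveAt (
    subst₂ _≤_ (cong (u *_) (sym (shift 2))) (sym (cong₂ _*_ (shift 1) (shift 1))) (n*[n∸4]≤[n∸2]*[n∸2] u))
    where
    u = v ∸ 2 * k
    shift : ∀ j → v ∸ 2 * (j + k) ≡ u ∸ 2 * j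
    shift j = trans (cong (v ∸_) (trans (*-distribˡ-+ 2 j k) (+-comm (2 * j) (2 * k))))
                    (sym (∸-+-assoc v (2 * k) (2 * j)))

  ballot : ℕ → ℕ → ℕ
  ballot n k = n C k ∸ binomPred n k

  ballot-formula : ∀ n k → suc n * ballot n k ≡ (suc n ∸ 2 * k) * (suc n C k)
  ballot-formula n k = begin
      suc n * (n C k ∸ binomPred n k)
    ≡⟨ *-distribˡ-∸ (suc n) (n C k) (binomPred n k) ⟩
      suc n * (n C k) ∸ suc n * binomPred n k
    ≡⟨ cong₂ _∸_ (C-absorption-complement n k) (binomPred-absorption n k) ⟩
      (suc n ∸ k) * X ∸ k * X
    ≡⟨ sym (*-distribʳ-∸ X (suc n ∸ k) k) ⟩
      (suc n ∸ k ∸ k) * X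
    ≡⟨ cong (_* X) (∸-+-assoc (suc n) k k) ⟩
      (suc n ∸ (k + k)) * X
    ≡⟨ cong (λ j → (suc n ∸ (k + j)) * X) (sym (+-identityʳ k)) ⟩
      (suc n ∸ 2 * k) * X
    ∎
    where
    open ≡-Reasoning
    X = suc n C k

  ballot-logConcave : ∀ n k → LogConcaveAt (ballot n) k
  ballot-logConcave n k =
    LogConcaveAt-scale {f = ballot n} (suc n) (ballot-formula n)
      (LogConcaveAt-* (∸2*-logConcave (suc n) k) (C-logConcave (suc n) k))

  0<ballot : ∀ n k → 2 * k ≤ n → 0 < ballot n k
  0<ballot n k 2k≤n = *-cancelˡ-< (suc n) 0 (ballot n k) (begin-strict
      suc n * 0                       ≡⟨ *-zeroʳ (suc n) ⟩
      0                               <⟨ *-mono-< (m<n⇒0<n∸m (s≤s 2k≤n)) (0<C k≤1+n) ⟩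
      (suc n ∸ 2 * k) * (suc n C k)   ≡⟨ sym (ballot-formula n k) ⟩
      suc n * ballot n k              ∎)
    where
    open ≤-Reasoning
    k≤1+n : k ≤ suc n
    k≤1+n = m≤n⇒m≤1+n (≤-trans (m≤n*m k 2) 2k≤n)

  *-≤-chain : ∀ a d x y {b c} → a * c ≤ b * x → b * d ≤ c * y → 0 < b → 0 < c → a * d ≤ x * y
  *-≤-chain a d x y {b} {c} ac≤bx bd≤cy 0<b 0<c =
    *-cancelˡ-≤ (b * c) {{>-nonZero (*-mono-< 0<b 0<c)}} (begin
      b * c * (a * d)     ≡⟨ rearrange a b c d ⟩
      a * c * (b * d)     ≤⟨ *-mono-≤ ac≤bx bd≤cy ⟩
      b * x * (c * y)     ≡⟨ interchange b x c y ⟩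
      b * c * (x * y)     ∎)
    where
    open ≤-Reasoning
    rearrange : ∀ a b c d → b * c * (a * d) ≡ a * c * (b * d)
    rearrange = solve-∀

  LogConcaveAt-evens : ∀ {f} i → (∀ j → LogConcaveAt f j) → (∀ {j} → j < 2 * (2 + i) → 0 < f j) →
                       LogConcaveAt (λ j → f (2 * j)) i
  LogConcaveAt-evens {f} i lc positive = logConcaveAt (
    subst₂ _≤_ (cong (λ j → f k * f j) (sym (*-distribˡ-+ 2 2 i)))
               (sym (cong₂ (λ j j′ → f j * f j′) (*-distribˡ-+ 2 1 i) (*-distribˡ-+ 2 1 i)))
               (*-≤-chain (f k) (f (4 + k)) (f (2 + k)) (f (2 + k))
                  f[k]*f[3+k]≤ (≤-trans f[1+k]*f[4+k]≤ (≤-reflexive (*-comm (f (2 + k)) (f (3 + k)))))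
                  0<f[1+k] 0<f[3+k]))
    where
    open LogConcaveAt
    k = 2 * i
    below : ∀ {j} → j ≤ 3 + k → j < 2 * (2 + i)
    below {j} j≤3+k = subst (j <_) (sym (*-distribˡ-+ 2 2 i)) (s≤s j≤3+k)
    0<f[1+k] : 0 < f (1 + k)
    0<f[1+k] = positive (below (m≤n+m (1 + k) 2))
    0<f[2+k] : 0 < f (2 + k)
    0<f[2+k] = positive (below (n≤1+n (2 + k)))
    0<f[3+k] : 0 < f (3 + k)
    0<f[3+k] = positive (below ≤-refl)
    f[k]*f[3+k]≤ : f k * f (3 + k) ≤ f (1 + k) * f (2 + k)
    f[k]*f[3+k]≤ = *-≤-chain (f k) (f (3 + k)) (f (1 + k)) (f (2 + k))
                     (inequality (lc k)) (inequality (lc (1 + k))) 0<f[1+k] 0<f[2+k]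
    f[1+k]*f[4+k]≤ : f (1 + k) * f (4 + k) ≤ f (2 + k) * f (3 + k)
    f[1+k]*f[4+k]≤ = *-≤-chain (f (1 + k)) (f (4 + k)) (f (2 + k)) (f (3 + k))
                       (inequality (lc (1 + k))) (inequality (lc (2 + k))) 0<f[2+k] 0<f[3+k]

  j≤diam⇒2*j≤m : ∀ m {j} → j ≤ diam m → 2 * j ≤ m
  j≤diam⇒2*j≤m m j≤d = ≤-trans (*-monoʳ-≤ 2 j≤d) (subst (_≤ m) (*-comm (m / 2) 2) (m/n*n≤m m 2))

  evenBallots-logConcave : ∀ m i → 2 + i ≤ diam m → LogConcaveAt (λ j → ballot (2 * m) (2 * j)) i
  evenBallots-logConcave m i 2+i≤d = LogConcaveAt-evens i (ballot-logConcave (2 * m)) positive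
    where
    positive : ∀ {j} → j < 2 * (2 + i) → 0 < ballot (2 * m) j
    positive {j} j< = 0<ballot (2 * m) j (*-monoʳ-≤ 2 (≤-trans (<⇒≤ j<) (j≤diam⇒2*j≤m m 2+i≤d)))

  mult≡ballot : ∀ m {j} → j ≤ diam m → mult m j ≡ ℤ.+ ballot (2 * m) (2 * j)
  mult≡ballot m {j} j≤d = trans (m-n≡m⊖n C[2m,2j] binomPred[2m,2j]) (⊖-≥ binomPred≤C)
    where
    C[2m,2j] = (2 * m) C (2 * j)
    binomPred[2m,2j] = binomPred (2 * m) (2 * j)
    binomPred≤C : binomPred[2m,2j] ≤ C[2m,2j]
    binomPred≤C =
      <⇒≤ (m∸n≢0⇒n<m (n>0⇒n≢0 (0<ballot (2 * m) (2 * j) (*-monoʳ-≤ 2 (j≤diam⇒2*j≤m m j≤d)))))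

  mult*mult≡ballot*ballot : ∀ m {j j′} → j ≤ diam m → j′ ≤ diam m →
    mult m j ℤ.* mult m j′ ≡ ℤ.+ (ballot (2 * m) (2 * j) * ballot (2 * m) (2 * j′))
  mult*mult≡ballot*ballot m {j} {j′} j≤d j′≤d =
    trans (cong₂ ℤ._*_ (mult≡ballot m j≤d) (mult≡ballot m j′≤d))
          (sym (pos-* (ballot (2 * m) (2 * j)) (ballot (2 * m) (2 * j′))))

open BallotNumbers using (LogConcaveAt; evenBallots-logConcave; mult*mult≡ballot*ballot)
open import Data.Nat.Properties using (≤-trans; n≤1+n)
open import Data.Integer using (_*_; +≤+) renaming (_≤_ to _≤ℤ_)
open import Relation.Binary.PropositionalEquality using (subst₂; sym)

-- The hypothesis 4 ≤ m follows from the other two.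
corollary6 : (m : ℕ) → 4 ≤ m → (i : ℕ) → 1 ≤ i → suc i ≤ diam m →
    mult m (pred i) * mult m (suc i) ≤ℤ mult m i * mult m i
corollary6 m _ (suc i) _ 2+i≤d =
  subst₂ _≤ℤ_ (sym (mult*mult≡ballot*ballot m i≤d 2+i≤d))
              (sym (mult*mult≡ballot*ballot m 1+i≤d 1+i≤d))
    (+≤+ (LogConcaveAt.inequality (evenBallots-logConcave m i 2+i≤d)))
  where
  1+i≤d : suc i ≤ diam m
  1+i≤d = ≤-trans (n≤1+n (suc i)) 2+i≤d
  i≤d : i ≤ diam m
  i≤d = ≤-trans (n≤1+n i) 1+i≤d
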